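{- Let $X$ be the set of shuffle tableaux of shape $(\lambda/\mu)\circledast(\nu/\rho)$ with entries in $[N]$ flagged by a nondecreasing flag $\vec b$. Then $X$ is an extremal subset of the crystal $\mathcal B$ of all shuffle tableaux of that shape with entries in $[N]$: for every $i$-string $S$ of $\mathcal B$, $S\cap X$ is $\emptyset$, $S$, or $\{b\}$ where $e_i(b)=0$.
   Context: A shuffle tableau of shape $(\lambda/\mu)\circledast(\nu/\rho)$ ($n$ rows each) is a pair $(T,U)$ of semistandard tableaux of shapes $\lambda/\mu$, $\nu/\rho$; row $r$ of $T$ sits at level $2r-1$, row $r$ of $U$ at level $2r$. Reading word: levels $2n,\dots,1$, each left to right. An $i$ in cell $(r,c)$ and $i+1$ in cell $(r+1,c)$ of the same tableau are column paired. For $e_i,f_i$: remove column-paired $(i,i+1)$ pairs, bracket-match remaining $i$'s (")") and $i+1$'s ("("); $e_i$ turns the leftmost unpaired $i+1$ into $i$, $f_i$ the rightmost unpaired $i$ into $i+1$ ($0$ if none). Flagged by $\vec b=(b_1\le\dots\le b_{2n})$: entries at level $\ell$ are $\le b_\ell$. An $i$-string is a maximal sequence $b_1,\dots,b_k$ with $b_j=f_i(b_{j-1})$, $e_i(b_1)=0$, $f_i(b_k)=0$. -}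

module Defs where

open import Data.Nat using (ℕ; zero; suc; _+_; _*_; _∸_; _≤_; _<_; _≟_; _≤?_)
open import Data.Bool using (Bool; true; false; if_then_else_; _∧_; not)
open import Data.List using (List; []; _∷_; _++_; concatMap; downFrom)
open import Data.Vec using (Vec; []; _∷_; lookup)
open import Data.Fin using (Fin)
import Data.Fin as F
open import Data.Maybe using (Maybe; just; nothing)
open import Data.Product using (_×_; _,_; ∃)
open import Data.Sum using (_⊎_)
open import Relation.Binary.PropositionalEquality using (_≡_)
open import Relation.Nullary using (¬_)
open import Relation.Nullary.Decidable using (⌊_⌋)
open import Data.List.Relation.Unary.All using (All)
open import Data.List.Membership.Propositional using (_∈_)

vnth : ∀ {A : Set} {n} → Vec A n → ℕ → Maybe A
vnth [] _ = nothing
vnth (x ∷ xs) zero = just x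
vnth (x ∷ xs) (suc k) = vnth xs k

lnth : ∀ {A : Set} → List A → ℕ → Maybe A
lnth [] _ = nothing
lnth (x ∷ xs) zero = just x
lnth (x ∷ xs) (suc k) = lnth xs k

lset : ∀ {A : Set} → List A → ℕ → A → List A
lset [] _ _ = []
lset (x ∷ xs) zero v = v ∷ xs
lset (x ∷ xs) (suc k) v = x ∷ lset xs k v

vmod : ∀ {A : Set} {n} → Vec A n → ℕ → (A → A) → Vec A n
vmod [] _ g = []
vmod (x ∷ xs) zero g = g x ∷ xs
vmod (x ∷ xs) (suc k) g = x ∷ vmod xs k g

lastM : ∀ {A : Set} → List A → Maybe A
lastM [] = nothing
lastM (x ∷ []) = just x
lastM (x ∷ y ∷ ys) = lastM (y ∷ ys)

eqMN : Maybe ℕ → ℕ → Bool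
eqMN nothing _ = false
eqMN (just a) b = ⌊ a ≟ b ⌋

IsPartition : ∀ {n} → Vec ℕ n → Set
IsPartition {n} la = ∀ (r s : Fin n) → r F.≤ s → lookup la s ≤ lookup la r

_⊆ₚ_ : ∀ {n} → Vec ℕ n → Vec ℕ n → Set
_⊆ₚ_ {n} mu la = ∀ (r : Fin n) → lookup mu r ≤ lookup la r

-- Fillings of a skew shape lam/mu with n rows.
-- Row r (0-based) is the list of entries in columns mu_r+1, ..., lam_r
-- (columns are 1-based), read left to right.

Filling : ℕ → Set
Filling n = Vec (List ℕ) n

-- entry at row r (0-based), column c (1-based); nothing if not a cell
entry : ∀ {n} → Vec ℕ n → Filling n → ℕ → ℕ → Maybe ℕ
entry mu T r c with vnth mu r | vnth T r
... | just m | just row = if ⌊ c ≤? m ⌋ then nothing else lnth row (c ∸ suc m)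
... | _ | _ = nothing

setEntry : ∀ {n} → Vec ℕ n → Filling n → ℕ → ℕ → ℕ → Filling n
setEntry mu T r c v with vnth mu r
... | just m = vmod T r (λ row → lset row (c ∸ suc m) v)
... | nothing = T

record SSYT {n : ℕ} (N : ℕ) (lam mu : Vec ℕ n) (T : Filling n) : Set where
  field
    rowLengths : ∀ (r : Fin n) → Data.List.length (lookup T r) ≡ lookup lam r ∸ lookup mu r
    inRange    : ∀ r c a → entry mu T r c ≡ just a → 1 ≤ a × a ≤ N
    rowWeak    : ∀ r c a a' → entry mu T r c ≡ just a → entry mu T r (suc c) ≡ just a' → a ≤ a'
    colStrict  : ∀ r c a a' → entry mu T r c ≡ just a → entry mu T (suc r) c ≡ just a' → a < a'

-- Shuffle tableaux of shape (lam/mu) ⊛ (nu/rho)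

ShT : ℕ → Set
ShT n = Filling n × Filling n

InB : ∀ {n} (N : ℕ) (lam mu nu rho : Vec ℕ n) → ShT n → Set
InB N lam mu nu rho (T , U) = SSYT N lam mu T × SSYT N nu rho U

-- flags b = (b_1 ≤ ... ≤ b_2n), stored 0-based: level ℓ ↦ index ℓ-1
Nondecreasing : ∀ {m} → Vec ℕ m → Set
Nondecreasing {m} b = ∀ (i j : Fin m) → i F.≤ j → lookup b i ≤ lookup b j

-- row r (0-based) of T is at level 2r+1 (index 2r), row r of U at level 2r+2 (index 2r+1)
Flagged : ∀ {n} → Vec ℕ n → Vec ℕ n → Vec ℕ (2 * n) → ShT n → Set
Flagged mu rho b (T , U) =
  (∀ r c a β → entry mu T r c ≡ just a → vnth b (2 * r) ≡ just β → a ≤ β) ×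
  (∀ r c a β → entry rho U r c ≡ just a → vnth b (suc (2 * r)) ≡ just β → a ≤ β)

InX : ∀ {n} (N : ℕ) (lam mu nu rho : Vec ℕ n) → Vec ℕ (2 * n) → ShT n → Set
InX N lam mu nu rho b t = InB N lam mu nu rho t × Flagged mu rho b t

data Tab : Set where
  tT tU : Tab

-- a cell: which tableau, row (0-based), column (1-based)
Cell : Set
Cell = Tab × ℕ × ℕ

entryAt : ∀ {n} → Vec ℕ n → Vec ℕ n → ShT n → Cell → Maybe ℕ
entryAt mu rho (T , U) (tT , r , c) = entry mu T r c
entryAt mu rho (T , U) (tU , r , c) = entry rho U r c

setCell : ∀ {n} → Vec ℕ n → Vec ℕ n → ShT n → Cell → ℕ → ShT n
setCell mu rho (T , U) (tT , r , c) v = setEntry mu T r c v , U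
setCell mu rho (T , U) (tU , r , c) v = T , setEntry rho U r c v

rowCells : Tab → ℕ → ℕ → List ℕ → List (Cell × ℕ)
rowCells t r m [] = []
rowCells t r m (a ∷ as) = ((t , r , suc m) , a) ∷ rowCells t r (suc m) as

rowOf : ∀ {n} → Filling n → ℕ → List ℕ
rowOf T r with vnth T r
... | just row = row
... | nothing = []

shapeAt : ∀ {n} → Vec ℕ n → ℕ → ℕ
shapeAt mu r with vnth mu r
... | just m = m
... | nothing = 0

-- levels 2n, 2n-1, ..., 1, each left to right
readingWord : ∀ {n} → Vec ℕ n → Vec ℕ n → ShT n → List (Cell × ℕ)
readingWord {n} mu rho (T , U) =
  concatMap (λ r → rowCells tU r (shapeAt rho r) (rowOf U r)
                   ++ rowCells tT r (shapeAt mu r) (rowOf T r))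
            (downFrom n)

-- column pairing: i at (r,c) and i+1 at (r+1,c) of the same tableau
colPaired : ∀ {n} → Vec ℕ n → Vec ℕ n → ℕ → ShT n → Cell → ℕ → Bool
colPaired mu rho i t (tb , r , c) v =
  if ⌊ v ≟ i ⌋ then eqMN (entryAt mu rho t (tb , suc r , c)) (suc i)
  else (if ⌊ v ≟ suc i ⌋ then prev r else false)
  where
    prev : ℕ → Bool
    prev zero = false
    prev (suc r') = eqMN (entryAt mu rho t (tb , r' , c)) i

data Br : Set where
  cls opn : Br   -- cls = ")" (an i), opn = "(" (an i+1)

brackets : ∀ {n} → Vec ℕ n → Vec ℕ n → ℕ → ShT n → List (Cell × ℕ) → List (Cell × Br)
brackets mu rho i t [] = []
brackets mu rho i t ((x , v) ∷ w) =
  if colPaired mu rho i t x v then rest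
  else (if ⌊ v ≟ i ⌋ then (x , cls) ∷ rest
        else (if ⌊ v ≟ suc i ⌋ then (x , opn) ∷ rest else rest))
  where rest = brackets mu rho i t w

-- bracket matching; returns (unmatched i's, unmatched i+1's), each rightmost first
unmatched : List Cell → List Cell → List (Cell × Br) → List Cell × List Cell
unmatched cl op [] = cl , op
unmatched cl [] ((x , cls) ∷ w) = unmatched (x ∷ cl) [] w
unmatched cl (_ ∷ op) ((x , cls) ∷ w) = unmatched cl op w
unmatched cl op ((x , opn) ∷ w) = unmatched cl (x ∷ op) w

unm : ∀ {n} → Vec ℕ n → Vec ℕ n → ℕ → ShT n → List Cell × List Cell
unm mu rho i t = unmatched [] [] (brackets mu rho i t (readingWord mu rho t))

-- e_i: leftmost unpaired i+1 becomes i (nothing = 0)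
eOp : ∀ {n} → Vec ℕ n → Vec ℕ n → ℕ → ShT n → Maybe (ShT n)
eOp mu rho i t with unm mu rho i t
... | (_ , op) with lastM op
...   | nothing = nothing
...   | just x = just (setCell mu rho t x i)

-- f_i: rightmost unpaired i becomes i+1 (nothing = 0)
fOp : ∀ {n} → Vec ℕ n → Vec ℕ n → ℕ → ShT n → Maybe (ShT n)
fOp mu rho i t with unm mu rho i t
... | ([] , _) = nothing
... | (x ∷ _ , _) = just (setCell mu rho t x (suc i))

data FChain {n : ℕ} (mu rho : Vec ℕ n) (i : ℕ) : ShT n → List (ShT n) → Set where
  fend  : ∀ {b} → fOp mu rho i b ≡ nothing → FChain mu rho i b []
  fstep : ∀ {b b' rest} → fOp mu rho i b ≡ just b' → FChain mu rho i b' rest →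
          FChain mu rho i b (b' ∷ rest)

IsString : ∀ {n} (N : ℕ) (lam mu nu rho : Vec ℕ n) → ℕ → List (ShT n) → Set
IsString N lam mu nu rho i [] = Data.Empty.⊥
  where import Data.Empty
IsString N lam mu nu rho i (b ∷ rest) =
  All (InB N lam mu nu rho) (b ∷ rest) × eOp mu rho i b ≡ nothing × FChain mu rho i b rest

Extremal : ∀ {n} (N : ℕ) (lam mu nu rho : Vec ℕ n) → (ShT n → Set) → Set
Extremal {n} N lam mu nu rho X =
  ∀ (i : ℕ) → 1 ≤ i → suc i ≤ N → ∀ (S : List (ShT n)) → IsString N lam mu nu rho i S →
    (∀ x → x ∈ S → ¬ X x)
    ⊎ (∀ x → x ∈ S → X x)
    ⊎ (∃ λ x → x ∈ S × X x × eOp mu rho i x ≡ nothing × (∀ y → y ∈ S → X y → y ≡ x))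

-- f_i turns the rightmost unpaired i into i+1, so along an i-string the entries only grow and a
-- flag, once violated, stays violated. Raising an unpaired i does not change the column pairing of
-- any other letter (column strictness), so after the raise the unpaired i's are exactly the
-- remaining ones, all of which precede the raised cell in the reading word and hence sit at a level
-- at least as high. Thus if the head s₀ of a string and f_i(s₀) are both flagged, the first raised
-- cell accepts i+1, every later one sits under a flag at least as large, and the whole string is
-- flagged.

module Submission where

open import Defs
open import Data.Nat using (ℕ; zero; suc; _+_; _*_; _∸_; _≤_; _<_; _≟_; _≤?_; z≤n; s≤s)
open import Data.Nat.Properties using (≟-diag; 1+n≢n; <-irrefl; m+[n∸m]≡n; ≰⇒>; m+n≮m; m+n∸m≡n; +-identityʳ; +-suc; m≤m+n; ≤-refl; ≤-trans; n≤1+n; ≤-reflexive; *-suc; <-≤-trans; *-monoʳ-≤; <⇒≤; n<1+n; ≤-<-trans)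
open import Data.Bool using (Bool; true; false; if_then_else_)
open import Data.List using (List; []; _∷_; _++_; [_]; map; concatMap; downFrom)
open import Data.List.Properties using (++-assoc; ∷-injectiveˡ; ++-conicalʳ; map-id-local; map-++; concatMap-cong; map-concatMap)
open import Data.List.Relation.Unary.All as All using (All; []; _∷_)
import Data.List.Relation.Unary.All.Properties as All
open import Data.List.Relation.Unary.AllPairs using (AllPairs; []; _∷_)
import Data.List.Relation.Unary.AllPairs.Properties as AllPairs
open import Data.List.Relation.Unary.Any using (here; there)
open import Data.List.Membership.Propositional using (_∈_; find; lose)
open import Data.List.Membership.Propositional.Properties using (∈-++⁻; ∈-++⁺ˡ; ∈-++⁺ʳ; ∈-concatMap⁺; ∈-concatMap⁻; ∈-downFrom⁺; ∈-downFrom⁻; ∈-∃++; ∈-map⁺; ∈-map⁻)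
open import Data.Vec using (Vec; []; _∷_; lookup)
open import Data.Fin using (fromℕ<)
open import Data.Fin.Properties using (toℕ-fromℕ<)
open import Data.Maybe as Maybe using (Maybe; just; nothing)
open import Data.Maybe.Properties using (just-injective)
open import Data.Product using (_×_; _,_; proj₁; proj₂; ∃; ∃₂)
open import Data.Product.Properties using (≡-dec)
open import Data.Sum using (_⊎_; inj₁; inj₂)
open import Data.Empty using (⊥-elim)
open import Function using (_on_; _∘_; id)
open import Relation.Binary.Definitions using (DecidableEquality)
open import Relation.Binary.PropositionalEquality using (_≡_; _≢_; refl; sym; trans; cong; cong₂; subst; subst₂; module ≡-Reasoning)
open import Relation.Nullary using (Dec; yes; no; ¬_)
open import Relation.Nullary.Decidable using (⌊_⌋; map′)

head-∈ : ∀ {A : Set} {xs y} {ys : List A} → xs ≡ y ∷ ys → y ∈ xs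
head-∈ refl = here refl

just-ext : ∀ {A : Set} {m m′ : Maybe A} →
  (∀ {a} → m ≡ just a → m′ ≡ just a) → (∀ {a} → m′ ≡ just a → m ≡ just a) → m ≡ m′
just-ext {m = just a} to _ = sym (to refl)
just-ext {m = nothing} {just a} _ from = from refl
just-ext {m = nothing} {nothing} _ _ = refl

AllPairs-middle : ∀ {A : Set} {R : A → A → Set} u {p} w → AllPairs R (u ++ p ∷ w) →
  All (λ q → R q p) u × All (R p) w
AllPairs-middle [] w (Rp ∷ _) = [] , Rp
AllPairs-middle (q ∷ u) w (Rq ∷ Ruw) =
  let before , after = AllPairs-middle u w Ruw in All.head (All.++⁻ʳ u Rq) ∷ before , after

All-replace-middle : ∀ {A : Set} {P : A → Set} u {p q} w →
  All P (u ++ p ∷ w) → P q → All P (u ++ q ∷ w)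
All-replace-middle u w Puw Pq with Pu , _ ∷ Pw ← All.++⁻ u Puw = All.++⁺ Pu (Pq ∷ Pw)

closers : List Cell → List (Cell × Br) → List Cell
closers op w = proj₁ (unmatched [] op w)

unmatched-++ : ∀ cl op u v →
  unmatched cl op (u ++ v) ≡ unmatched (proj₁ (unmatched cl op u)) (proj₂ (unmatched cl op u)) v
unmatched-++ cl op [] v = refl
unmatched-++ cl [] ((x , cls) ∷ u) v = unmatched-++ (x ∷ cl) [] u v
unmatched-++ cl (_ ∷ op) ((x , cls) ∷ u) v = unmatched-++ cl op u v
unmatched-++ cl [] ((x , opn) ∷ u) v = unmatched-++ cl [ x ] u v
unmatched-++ cl (o ∷ op) ((x , opn) ∷ u) v = unmatched-++ cl (x ∷ o ∷ op) u v

closers-acc : ∀ cl op w → proj₁ (unmatched cl op w) ≡ closers op w ++ cl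
closers-acc cl op [] = refl
closers-acc cl [] ((x , cls) ∷ w) = begin
  proj₁ (unmatched (x ∷ cl) [] w)   ≡⟨ closers-acc (x ∷ cl) [] w ⟩
  closers [] w ++ [ x ] ++ cl       ≡⟨ ++-assoc (closers [] w) [ x ] cl ⟨
  (closers [] w ++ [ x ]) ++ cl     ≡⟨ cong (_++ cl) (closers-acc [ x ] [] w) ⟨
  closers [] ((x , cls) ∷ w) ++ cl  ∎
  where open ≡-Reasoning
closers-acc cl (_ ∷ op) ((x , cls) ∷ w) = closers-acc cl op w
closers-acc cl [] ((x , opn) ∷ w) = closers-acc cl [ x ] w
closers-acc cl (o ∷ op) ((x , opn) ∷ w) = closers-acc cl (x ∷ o ∷ op) w

closers-∈ : ∀ op w {y} → y ∈ closers op w → (y , cls) ∈ w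
closers-∈ [] ((x , cls) ∷ w) y∈ rewrite closers-acc [ x ] [] w with ∈-++⁻ (closers [] w) y∈
... | inj₁ y∈w = there (closers-∈ [] w y∈w)
... | inj₂ (here refl) = here refl
closers-∈ (_ ∷ op) ((x , cls) ∷ w) y∈ = there (closers-∈ op w y∈)
closers-∈ [] ((x , opn) ∷ w) y∈ = there (closers-∈ [ x ] w y∈)
closers-∈ (o ∷ op) ((x , opn) ∷ w) y∈ = there (closers-∈ (x ∷ o ∷ op) w y∈)

closers-++-openers : ∀ op e w → closers op w ≡ [] → closers (op ++ e) w ≡ []
closers-++-openers op e [] _ = refl
closers-++-openers [] e ((x , cls) ∷ w) none rewrite closers-acc [ x ] [] w
  with () ← ++-conicalʳ (closers [] w) [ x ] none
closers-++-openers (_ ∷ op) e ((x , cls) ∷ w) none = closers-++-openers op e w none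
closers-++-openers [] [] ((x , opn) ∷ w) none = none
closers-++-openers [] (e₀ ∷ e) ((x , opn) ∷ w) none = closers-++-openers [ x ] (e₀ ∷ e) w none
closers-++-openers (o ∷ op) e ((x , opn) ∷ w) none = closers-++-openers (x ∷ o ∷ op) e w none

-- x is the rightmost unmatched closer only if u leaves no opener pending and v has no unmatched
-- closer; turned into an opener, x then finds nothing in v to match.
raise-rightmost-closer : ∀ x rest u v →
  (∀ y → (y , cls) ∈ u → y ≢ x) → (∀ y → (y , cls) ∈ v → y ≢ x) →
  closers [] (u ++ (x , cls) ∷ v) ≡ x ∷ rest →
  closers [] (u ++ (x , opn) ∷ v) ≡ rest × rest ≡ closers [] u
raise-rightmost-closer x rest u v x∉u x∉v h
  rewrite unmatched-++ [] [] u ((x , cls) ∷ v) | unmatched-++ [] [] u ((x , opn) ∷ v)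
  with unmatched [] [] u in eq-u
... | (c , []) rewrite closers-acc (x ∷ c) [] v | closers-acc c [ x ] v with closers [] v in eq-v
...   | [] rewrite closers-++-openers [] [ x ] v eq-v with refl ← h = refl , refl
...   | y ∷ _ = ⊥-elim (x∉v y (closers-∈ [] v (head-∈ eq-v)) (∷-injectiveˡ h))
raise-rightmost-closer x rest u v x∉u x∉v h | (c , _ ∷ o)
  rewrite closers-acc c o v with closers o v in eq-v
... | y ∷ _ = ⊥-elim (x∉v y (closers-∈ o v (head-∈ eq-v)) (∷-injectiveˡ h))
... | [] = ⊥-elim (x∉u x (closers-∈ [] u (subst (x ∈_) (cong proj₁ (sym eq-u)) (head-∈ h))) refl)

_≟ᵗ_ : DecidableEquality Tab
tT ≟ᵗ tT = yes refl
tT ≟ᵗ tU = no (λ ())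
tU ≟ᵗ tT = no (λ ())
tU ≟ᵗ tU = yes refl

_≟ᶜ_ : DecidableEquality Cell
_≟ᶜ_ = ≡-dec _≟ᵗ_ (≡-dec _≟_ _≟_)

-- The index in b of the flag of a cell: its level in the paper minus one.
rowLevel : Tab → ℕ → ℕ
rowLevel tT r = 2 * r
rowLevel tU r = suc (2 * r)

level : Cell → ℕ
level (t , r , _) = rowLevel t r

rowIndex : Cell → ℕ
rowIndex (_ , r , _) = r

column : Cell → ℕ
column (_ , _ , c) = c

level<2*suc-row : ∀ y → level y < 2 * suc (rowIndex y)
level<2*suc-row (tT , r , _) = ≤-trans (n≤1+n _) (≤-reflexive (sym (*-suc 2 r)))
level<2*suc-row (tU , r , _) = ≤-reflexive (sym (*-suc 2 r))

2*row≤level : ∀ y → 2 * rowIndex y ≤ level y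
2*row≤level (tT , r , _) = ≤-refl
2*row≤level (tU , r , _) = n≤1+n (2 * r)

row-<⇒level-< : ∀ {y z} → rowIndex y < rowIndex z → level y < level z
row-<⇒level-< {y} {z} lt =
  <-≤-trans (level<2*suc-row y) (≤-trans (*-monoʳ-≤ 2 lt) (2*row≤level z))

_≺_ : Cell → Cell → Set
y ≺ z = level z < level y ⊎ (level y ≡ level z × column y < column z)

≺⇒≢ : ∀ {y z} → y ≺ z → y ≢ z
≺⇒≢ (inj₁ lt) refl = <-irrefl refl lt
≺⇒≢ (inj₂ (_ , lt)) refl = <-irrefl refl lt

≺⇒level-≥ : ∀ {y z} → y ≺ z → level z ≤ level y
≺⇒level-≥ (inj₁ lt) = <⇒≤ lt
≺⇒level-≥ (inj₂ (e , _)) = ≤-reflexive (sym e)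

relabel : Cell → ℕ → Cell × ℕ → Cell × ℕ
relabel x v (y , a) = y , (if ⌊ y ≟ᶜ x ⌋ then v else a)

relabel-≢ : ∀ {x y} v a → y ≢ x → relabel x v (y , a) ≡ (y , a)
relabel-≢ {x} {y} v a y≢x with y ≟ᶜ x
... | yes y≡x = ⊥-elim (y≢x y≡x)
... | no _ = refl

relabel-self : ∀ x v a → relabel x v (x , a) ≡ (x , v)
relabel-self x v a with x ≟ᶜ x
... | yes _ = refl
... | no x≢x = ⊥-elim (x≢x refl)

map-relabel-∉ : ∀ {x} v {w} → All (λ p → proj₁ p ≢ x) w → map (relabel x v) w ≡ w
map-relabel-∉ v x∉w = map-id-local (All.map (λ {p} → relabel-≢ v (proj₂ p)) x∉w)

∈-map-relabel⁻ : ∀ {x y a} v w → y ≢ x → (y , a) ∈ map (relabel x v) w → (y , a) ∈ w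
∈-map-relabel⁻ {x} v w y≢x q with (z , b) , z∈ , e ← ∈-map⁻ (relabel x v) q
  with refl ← cong proj₁ e = subst (_∈ w) (sym (trans e (relabel-≢ v b y≢x))) z∈

∈-map-relabel⁺ : ∀ {x y a} v w → y ≢ x → (y , a) ∈ w → (y , a) ∈ map (relabel x v) w
∈-map-relabel⁺ {x} v w y≢x q =
  subst (_∈ map (relabel x v) w) (relabel-≢ v _ y≢x) (∈-map⁺ (relabel x v) q)

vnth-< : ∀ {A : Set} {n} (v : Vec A n) r {a} → vnth v r ≡ just a → r < n
vnth-< (x ∷ v) zero e = s≤s z≤n
vnth-< (x ∷ v) (suc r) e = s≤s (vnth-< v r e)

vnth-∃ : ∀ {A : Set} {n} (v : Vec A n) {r} → r < n → ∃ λ a → vnth v r ≡ just a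
vnth-∃ (x ∷ v) {zero} _ = x , refl
vnth-∃ (x ∷ v) {suc r} (s≤s r<n) = vnth-∃ v r<n

vnth-fromℕ< : ∀ {A : Set} {m} (v : Vec A m) {ℓ} (ℓ<m : ℓ < m) →
  vnth v ℓ ≡ just (lookup v (fromℕ< ℓ<m))
vnth-fromℕ< (x ∷ v) {zero} _ = refl
vnth-fromℕ< (x ∷ v) {suc ℓ} (s≤s ℓ<m) = vnth-fromℕ< v ℓ<m

vnth-mono : ∀ {m} (b : Vec ℕ m) → Nondecreasing b → ∀ {ℓ ℓ′ β} → ℓ ≤ ℓ′ → vnth b ℓ′ ≡ just β →
  ∃ λ β′ → vnth b ℓ ≡ just β′ × β′ ≤ β
vnth-mono {m} b b-mono {ℓ} {ℓ′} ℓ≤ℓ′ e =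
  lookup b (fromℕ< ℓ<m) , vnth-fromℕ< b ℓ<m ,
  subst (lookup b (fromℕ< ℓ<m) ≤_) (just-injective (trans (sym (vnth-fromℕ< b ℓ′<m)) e))
    (b-mono (fromℕ< ℓ<m) (fromℕ< ℓ′<m)
      (subst₂ _≤_ (sym (toℕ-fromℕ< ℓ<m)) (sym (toℕ-fromℕ< ℓ′<m)) ℓ≤ℓ′))
  where ℓ′<m : ℓ′ < m
        ℓ′<m = vnth-< b ℓ′ e
        ℓ<m : ℓ < m
        ℓ<m = ≤-<-trans ℓ≤ℓ′ ℓ′<m

vnth-vmod-≡ : ∀ {A : Set} {n} (v : Vec A n) r g → vnth (vmod v r g) r ≡ Maybe.map g (vnth v r)
vnth-vmod-≡ [] r g = refl
vnth-vmod-≡ (x ∷ v) zero g = refl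
vnth-vmod-≡ (x ∷ v) (suc r) g = vnth-vmod-≡ v r g

vnth-vmod-≢ : ∀ {A : Set} {n} (v : Vec A n) {r r′} g → r′ ≢ r →
  vnth (vmod v r g) r′ ≡ vnth v r′
vnth-vmod-≢ [] g _ = refl
vnth-vmod-≢ (x ∷ v) {zero} {zero} g r′≢r = ⊥-elim (r′≢r refl)
vnth-vmod-≢ (x ∷ v) {zero} {suc r′} g _ = refl
vnth-vmod-≢ (x ∷ v) {suc r} {zero} g _ = refl
vnth-vmod-≢ (x ∷ v) {suc r} {suc r′} g r′≢r = vnth-vmod-≢ v g (r′≢r ∘ cong suc)

rowOf-vmod-≡ : ∀ {n} (Z : Filling n) {r} g → r < n → rowOf (vmod Z r g) r ≡ g (rowOf Z r)
rowOf-vmod-≡ Z {r} g r<n with row , e ← vnth-∃ Z r<n rewrite vnth-vmod-≡ Z r g | e = refl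

rowOf-vmod-≢ : ∀ {n} (Z : Filling n) {r r′} g → r′ ≢ r → rowOf (vmod Z r g) r′ ≡ rowOf Z r′
rowOf-vmod-≢ Z g r′≢r rewrite vnth-vmod-≢ Z g r′≢r = refl

entry⇒rowOf : ∀ {n} (sh : Vec ℕ n) (Z : Filling n) r c {a} → entry sh Z r c ≡ just a →
  r < n × ∃ λ k → c ≡ suc (shapeAt sh r + k) × lnth (rowOf Z r) k ≡ just a
entry⇒rowOf sh Z r c e with vnth sh r in e₁ | vnth Z r in e₂
... | just m | just row with c ≤? m
...   | no c≰m = vnth-< sh r e₁ , c ∸ suc m , sym (m+[n∸m]≡n (≰⇒> c≰m)) , e

rowOf⇒entry : ∀ {n} (sh : Vec ℕ n) (Z : Filling n) {r k a} → r < n →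
  lnth (rowOf Z r) k ≡ just a → entry sh Z r (suc (shapeAt sh r + k)) ≡ just a
rowOf⇒entry sh Z {r} {k} r<n e with m , e₁ ← vnth-∃ sh r<n | row , e₂ ← vnth-∃ Z r<n
  rewrite e₁ | e₂ with suc (m + k) ≤? m
... | yes m+k<m = ⊥-elim (m+n≮m m k m+k<m)
... | no _ rewrite m+n∸m≡n m k = e

setEntry-rowOf : ∀ {n} (sh : Vec ℕ n) (Z : Filling n) {r} k v → r < n →
  setEntry sh Z r (suc (shapeAt sh r + k)) v ≡ vmod Z r (λ row → lset row k v)
setEntry-rowOf sh Z {r} k v r<n with m , e ← vnth-∃ sh r<n rewrite e | m+n∸m≡n m k = refl

rowCells-∈⁻ : ∀ t r m row {y a} → (y , a) ∈ rowCells t r m row →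
  ∃ λ k → y ≡ (t , r , suc (m + k)) × lnth row k ≡ just a
rowCells-∈⁻ t r m (b ∷ row) (here refl) =
  0 , cong (λ c → t , r , suc c) (sym (+-identityʳ m)) , refl
rowCells-∈⁻ t r m (b ∷ row) (there q) with k , refl , e ← rowCells-∈⁻ t r (suc m) row q =
  suc k , cong (λ c → t , r , suc c) (sym (+-suc m k)) , e

rowCells-∈⁺ : ∀ t r m row k {a} → lnth row k ≡ just a →
  ((t , r , suc (m + k)) , a) ∈ rowCells t r m row
rowCells-∈⁺ t r m (b ∷ row) zero refl rewrite +-identityʳ m = here refl
rowCells-∈⁺ t r m (b ∷ row) (suc k) e rewrite +-suc m k = there (rowCells-∈⁺ t r (suc m) row k e)

rowCells-∉ : ∀ t r m row {x} → (∀ c → (t , r , c) ≡ x → c ≤ m) →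
  All (λ p → proj₁ p ≢ x) (rowCells t r m row)
rowCells-∉ t r m row x-left = All.tabulate λ q x∈ →
  let k , e , _ = rowCells-∈⁻ t r m row q in m+n≮m m k (x-left _ (trans (sym e) x∈))

rowCells-level : ∀ t r m row → All (λ p → level (proj₁ p) ≡ rowLevel t r) (rowCells t r m row)
rowCells-level t r m row = All.tabulate λ q →
  let _ , e , _ = rowCells-∈⁻ t r m row q in cong level e

rowCells-sorted : ∀ t r m row → AllPairs (_≺_ on proj₁) (rowCells t r m row)
rowCells-sorted t r m [] = []
rowCells-sorted t r m (b ∷ row) = All.tabulate later ∷ rowCells-sorted t r (suc m) row
  where later : ∀ {p} → p ∈ rowCells t r (suc m) row → (t , r , suc m) ≺ proj₁ p
        later q with k , refl , _ ← rowCells-∈⁻ t r (suc m) row q = inj₂ (refl , s≤s (s≤s (m≤m+n m k)))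

rowCells-lset : ∀ t r m row k v →
  rowCells t r m (lset row k v) ≡ map (relabel (t , r , suc (m + k)) v) (rowCells t r m row)
rowCells-lset t r m [] k v = refl
rowCells-lset t r m (b ∷ row) zero v rewrite +-identityʳ m =
  cong₂ _∷_ (sym (relabel-self (t , r , suc m) v b))
            (sym (map-relabel-∉ v (rowCells-∉ t r (suc m) row λ { _ refl → ≤-refl })))
rowCells-lset t r m (b ∷ row) (suc k) v rewrite +-suc m k =
  cong₂ _∷_ (sym (relabel-≢ v b λ e → <-irrefl (cong column e) (s≤s (s≤s (m≤m+n m k)))))
            (rowCells-lset t r (suc m) row k v)

rowCells-setEntry : ∀ {n} t (sh : Vec ℕ n) (Z : Filling n) {r} k v → r < n → ∀ r′ →
  rowCells t r′ (shapeAt sh r′) (rowOf (setEntry sh Z r (suc (shapeAt sh r + k)) v) r′)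
    ≡ map (relabel (t , r , suc (shapeAt sh r + k)) v) (rowCells t r′ (shapeAt sh r′) (rowOf Z r′))
rowCells-setEntry t sh Z {r} k v r<n r′ rewrite setEntry-rowOf sh Z k v r<n with r′ ≟ r
... | yes refl rewrite rowOf-vmod-≡ Z (λ row → lset row k v) r<n =
  rowCells-lset t r (shapeAt sh r) (rowOf Z r) k v
... | no r′≢r rewrite rowOf-vmod-≢ Z (λ row → lset row k v) r′≢r =
  sym (map-relabel-∉ v (rowCells-∉ t r′ _ _ λ { _ refl → ⊥-elim (r′≢r refl) }))

eqMN-self : ∀ a → eqMN (just a) a ≡ true
eqMN-self a rewrite ≟-diag (refl {x = a}) = refl

eqMN-≢ : ∀ {m b} → (∀ {a} → m ≡ just a → a ≢ b) → eqMN m b ≡ false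
eqMN-≢ {nothing} _ = refl
eqMN-≢ {just a} {b} ≢b with a ≟ b
... | yes a≡b = ⊥-elim (≢b refl a≡b)
... | no _ = refl

module _ {n : ℕ} (mu rho : Vec ℕ n) where

  levelPair : ShT n → ℕ → List (Cell × ℕ)
  levelPair (T , U) r =
    rowCells tU r (shapeAt rho r) (rowOf U r) ++ rowCells tT r (shapeAt mu r) (rowOf T r)

  readingWord≡levelPairs : ∀ s → readingWord mu rho s ≡ concatMap (levelPair s) (downFrom n)
  readingWord≡levelPairs (T , U) = refl

  readingWord-∈⁻ : ∀ s {y a} → (y , a) ∈ readingWord mu rho s → entryAt mu rho s y ≡ just a
  readingWord-∈⁻ (T , U) p∈ with find (∈-concatMap⁻ (levelPair (T , U)) {xs = downFrom n} p∈)
  ... | r , r∈ , p∈r with ∈-++⁻ (rowCells tU r (shapeAt rho r) (rowOf U r)) p∈r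
  ...   | inj₁ q with _ , refl , e ← rowCells-∈⁻ tU r (shapeAt rho r) (rowOf U r) q =
          rowOf⇒entry rho U (∈-downFrom⁻ r∈) e
  ...   | inj₂ q with _ , refl , e ← rowCells-∈⁻ tT r (shapeAt mu r) (rowOf T r) q =
          rowOf⇒entry mu T (∈-downFrom⁻ r∈) e

  readingWord-∈⁺ : ∀ s {y a} → entryAt mu rho s y ≡ just a → (y , a) ∈ readingWord mu rho s
  readingWord-∈⁺ (T , U) {tT , r , c} e with r<n , k , refl , e′ ← entry⇒rowOf mu T r c e =
    ∈-concatMap⁺ (levelPair (T , U)) {xs = downFrom n} (lose (∈-downFrom⁺ r<n)
      (∈-++⁺ʳ _ (rowCells-∈⁺ tT r (shapeAt mu r) (rowOf T r) k e′)))
  readingWord-∈⁺ (T , U) {tU , r , c} e with r<n , k , refl , e′ ← entry⇒rowOf rho U r c e =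
    ∈-concatMap⁺ (levelPair (T , U)) {xs = downFrom n} (lose (∈-downFrom⁺ r<n)
      (∈-++⁺ˡ (rowCells-∈⁺ tU r (shapeAt rho r) (rowOf U r) k e′)))

  levelPair-row : ∀ s r {p} → p ∈ levelPair s r → rowIndex (proj₁ p) ≡ r
  levelPair-row (T , U) r q with ∈-++⁻ (rowCells tU r (shapeAt rho r) (rowOf U r)) q
  ... | inj₁ q′ = let _ , e , _ = rowCells-∈⁻ tU r (shapeAt rho r) (rowOf U r) q′ in cong rowIndex e
  ... | inj₂ q′ = let _ , e , _ = rowCells-∈⁻ tT r (shapeAt mu r) (rowOf T r) q′ in cong rowIndex e

  levelPair-sorted : ∀ s r → AllPairs (_≺_ on proj₁) (levelPair s r)
  levelPair-sorted (T , U) r =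
    AllPairs.++⁺ (rowCells-sorted tU r (shapeAt rho r) (rowOf U r))
                 (rowCells-sorted tT r (shapeAt mu r) (rowOf T r))
      (All.map (λ eᵤ → All.map (λ eₜ → inj₁ (subst₂ _<_ (sym eₜ) (sym eᵤ) (n<1+n (2 * r))))
                               (rowCells-level tT r (shapeAt mu r) (rowOf T r)))
               (rowCells-level tU r (shapeAt rho r) (rowOf U r)))

  readingWord-sorted : ∀ s → AllPairs (_≺_ on proj₁) (readingWord mu rho s)
  readingWord-sorted s rewrite readingWord≡levelPairs s =
    AllPairs.concat⁺ (All.map⁺ (All.applyDownFrom⁺₂ id n (levelPair-sorted s)))
      (AllPairs.map⁺ (AllPairs.applyDownFrom⁺₁ id n λ {i} {j} j<i _ →
        All.tabulate λ {p} p∈ → All.tabulate λ {q} q∈ →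
          inj₁ (row-<⇒level-< {proj₁ q} {proj₁ p}
                 (subst₂ _<_ (sym (levelPair-row s j q∈)) (sym (levelPair-row s i p∈)) j<i))))

  levelPair-setCell : ∀ s x v {a} → entryAt mu rho s x ≡ just a → ∀ r′ →
    levelPair (setCell mu rho s x v) r′ ≡ map (relabel x v) (levelPair s r′)
  levelPair-setCell (T , U) x@(tT , r , c) v e r′ with r<n , k , refl , _ ← entry⇒rowOf mu T r c e =
    begin
      uRow ++ rowCells tT r′ (shapeAt mu r′) (rowOf (setEntry mu T r c v) r′)
        ≡⟨ cong₂ _++_ (sym (map-relabel-∉ v (rowCells-∉ tU r′ _ _ λ _ ())))
                      (rowCells-setEntry tT mu T k v r<n r′) ⟩
      map (relabel x v) uRow ++ map (relabel x v) tRow  ≡⟨ map-++ (relabel x v) uRow tRow ⟨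
      map (relabel x v) (uRow ++ tRow)                  ∎
    where open ≡-Reasoning
          uRow tRow : List (Cell × ℕ)
          uRow = rowCells tU r′ (shapeAt rho r′) (rowOf U r′)
          tRow = rowCells tT r′ (shapeAt mu r′) (rowOf T r′)
  levelPair-setCell (T , U) x@(tU , r , c) v e r′ with r<n , k , refl , _ ← entry⇒rowOf rho U r c e =
    begin
      rowCells tU r′ (shapeAt rho r′) (rowOf (setEntry rho U r c v) r′) ++ tRow
        ≡⟨ cong₂ _++_ (rowCells-setEntry tU rho U k v r<n r′)
                      (sym (map-relabel-∉ v (rowCells-∉ tT r′ _ _ λ _ ()))) ⟩
      map (relabel x v) uRow ++ map (relabel x v) tRow  ≡⟨ map-++ (relabel x v) uRow tRow ⟨
      map (relabel x v) (uRow ++ tRow)                  ∎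
    where open ≡-Reasoning
          uRow tRow : List (Cell × ℕ)
          uRow = rowCells tU r′ (shapeAt rho r′) (rowOf U r′)
          tRow = rowCells tT r′ (shapeAt mu r′) (rowOf T r′)

  readingWord-setCell : ∀ s x v {a} → entryAt mu rho s x ≡ just a →
    readingWord mu rho (setCell mu rho s x v) ≡ map (relabel x v) (readingWord mu rho s)
  readingWord-setCell s x v e = begin
    readingWord mu rho (setCell mu rho s x v)
      ≡⟨ readingWord≡levelPairs (setCell mu rho s x v) ⟩
    concatMap (levelPair (setCell mu rho s x v)) (downFrom n)
      ≡⟨ concatMap-cong (levelPair-setCell s x v e) (downFrom n) ⟩
    concatMap (map (relabel x v) ∘ levelPair s) (downFrom n)
      ≡⟨ map-concatMap (relabel x v) (levelPair s) (downFrom n) ⟨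
    map (relabel x v) (concatMap (levelPair s) (downFrom n))
      ≡⟨ cong (map (relabel x v)) (readingWord≡levelPairs s) ⟨
    map (relabel x v) (readingWord mu rho s)
      ∎
    where open ≡-Reasoning

  readingWord-setCell-middle : ∀ s x {a} v before after →
    readingWord mu rho s ≡ before ++ (x , a) ∷ after →
    All (λ p → proj₁ p ≢ x) before → All (λ p → proj₁ p ≢ x) after →
    readingWord mu rho (setCell mu rho s x v) ≡ before ++ (x , v) ∷ after
  readingWord-setCell-middle s x {a} v before after word x∉before x∉after = begin
    readingWord mu rho (setCell mu rho s x v)    ≡⟨ readingWord-setCell s x v x-a ⟩
    map (relabel x v) (readingWord mu rho s)      ≡⟨ cong (map (relabel x v)) word ⟩
    map (relabel x v) (before ++ (x , a) ∷ after) ≡⟨ map-++ (relabel x v) before ((x , a) ∷ after) ⟩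
    map (relabel x v) before ++ relabel x v (x , a) ∷ map (relabel x v) after
      ≡⟨ cong₂ _++_ (map-relabel-∉ v x∉before)
                    (cong₂ _∷_ (relabel-self x v a) (map-relabel-∉ v x∉after)) ⟩
    before ++ (x , v) ∷ after                     ∎
    where open ≡-Reasoning
          x-a : entryAt mu rho s x ≡ just a
          x-a = readingWord-∈⁻ s (subst (_ ∈_) (sym word) (∈-++⁺ʳ before (here refl)))

  AgreeExcept : Cell → ShT n → ShT n → Set
  AgreeExcept x s′ s = ∀ y → y ≢ x → entryAt mu rho s′ y ≡ entryAt mu rho s y

  setCell-agreeExcept : ∀ s x v {a} → entryAt mu rho s x ≡ just a →
    AgreeExcept x (setCell mu rho s x v) s
  setCell-agreeExcept s x v x-a y y≢x = just-ext
    (λ e → readingWord-∈⁻ s (∈-map-relabel⁻ v _ y≢x (subst (_ ∈_) relabelled (readingWord-∈⁺ _ e))))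
    (λ e → readingWord-∈⁻ _ (subst (_ ∈_) (sym relabelled) (∈-map-relabel⁺ v _ y≢x (readingWord-∈⁺ s e))))
    where relabelled : readingWord mu rho (setCell mu rho s x v) ≡ map (relabel x v) (readingWord mu rho s)
          relabelled = readingWord-setCell s x v x-a

  ColumnStrict : ShT n → Set
  ColumnStrict s = ∀ t r c {a a′} →
    entryAt mu rho s (t , r , c) ≡ just a → entryAt mu rho s (t , suc r , c) ≡ just a′ → a < a′

  module _ (i : ℕ) where

    bracket : Bool → Cell × ℕ → List (Cell × Br)
    bracket paired (x , v) =
      if paired then [] else
      if ⌊ v ≟ i ⌋ then [ (x , cls) ] else
      if ⌊ v ≟ suc i ⌋ then [ (x , opn) ] else []

    brackets-∷ : ∀ t x v w → brackets mu rho i t ((x , v) ∷ w)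
      ≡ bracket (colPaired mu rho i t x v) (x , v) ++ brackets mu rho i t w
    brackets-∷ t x v w = float (colPaired mu rho i t x v) ⌊ v ≟ i ⌋ ⌊ v ≟ suc i ⌋
      where
        R : List (Cell × Br)
        R = brackets mu rho i t w
        float : ∀ c d₁ d₂ →
          (if c then R else if d₁ then (x , cls) ∷ R else if d₂ then (x , opn) ∷ R else R)
          ≡ (if c then [] else if d₁ then [ (x , cls) ] else if d₂ then [ (x , opn) ] else []) ++ R
        float true _ _ = refl
        float false true _ = refl
        float false false true = refl
        float false false false = refl

    brackets-++ : ∀ t u w →
      brackets mu rho i t (u ++ w) ≡ brackets mu rho i t u ++ brackets mu rho i t w
    brackets-++ t [] w = refl
    brackets-++ t ((x , v) ∷ u) w = begin
      brackets mu rho i t ((x , v) ∷ u ++ w)         ≡⟨ brackets-∷ t x v (u ++ w) ⟩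
      B ++ brackets mu rho i t (u ++ w)              ≡⟨ cong (B ++_) (brackets-++ t u w) ⟩
      B ++ brackets mu rho i t u ++ W                ≡⟨ ++-assoc B _ _ ⟨
      (B ++ brackets mu rho i t u) ++ W              ≡⟨ cong (_++ W) (brackets-∷ t x v u) ⟨
      brackets mu rho i t ((x , v) ∷ u) ++ W         ∎
      where open ≡-Reasoning
            B W : List (Cell × Br)
            B = bracket (colPaired mu rho i t x v) (x , v)
            W = brackets mu rho i t w

    bracket-closer : ∀ x → bracket false (x , i) ≡ [ (x , cls) ]
    bracket-closer x rewrite ≟-diag (refl {x = i}) = refl

    bracket-opener : ∀ x → bracket false (x , suc i) ≡ [ (x , opn) ]
    bracket-opener x with suc i ≟ i
    ... | yes 1+i≡i = ⊥-elim (1+n≢n 1+i≡i)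
    ... | no _ rewrite ≟-diag (refl {x = suc i}) = refl

    bracket-∈ : ∀ c x v {y br} → (y , br) ∈ bracket c (x , v) → y ≡ x
    bracket-∈ false x v y∈ with v ≟ i | v ≟ suc i
    bracket-∈ false x v (here refl) | yes _ | _ = refl
    bracket-∈ false x v (here refl) | no _ | yes _ = refl

    bracket-cls-∈ : ∀ c x v {y} → (y , cls) ∈ bracket c (x , v) → y ≡ x × v ≡ i × c ≡ false
    bracket-cls-∈ false x v y∈ with v ≟ i | v ≟ suc i
    bracket-cls-∈ false x v (here refl) | yes v≡i | _ = refl , v≡i , refl
    bracket-cls-∈ false x v (here ()) | no _ | yes _

    brackets-∈ : ∀ t w {y br} → (y , br) ∈ brackets mu rho i t w → ∃ λ a → (y , a) ∈ w
    brackets-∈ t ((x , v) ∷ w) y∈ rewrite brackets-∷ t x v w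
      with ∈-++⁻ (bracket (colPaired mu rho i t x v) (x , v)) y∈
    ... | inj₁ q with refl ← bracket-∈ (colPaired mu rho i t x v) x v q = v , here refl
    ... | inj₂ q = let a , q′ = brackets-∈ t w q in a , there q′

    brackets-cls-∈ : ∀ t w {y} → (y , cls) ∈ brackets mu rho i t w →
      (y , i) ∈ w × colPaired mu rho i t y i ≡ false
    brackets-cls-∈ t ((x , v) ∷ w) y∈ rewrite brackets-∷ t x v w
      with ∈-++⁻ (bracket (colPaired mu rho i t x v) (x , v)) y∈
    ... | inj₁ q with refl , refl , unpaired ← bracket-cls-∈ (colPaired mu rho i t x v) x v q =
      here refl , unpaired
    ... | inj₂ q = let q′ , unpaired = brackets-cls-∈ t w q in there q′ , unpaired

    brackets-cong : ∀ t t′ w →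
      All (λ (y , a) → colPaired mu rho i t′ y a ≡ colPaired mu rho i t y a) w →
      brackets mu rho i t′ w ≡ brackets mu rho i t w
    brackets-cong t t′ [] [] = refl
    brackets-cong t t′ ((x , v) ∷ w) (e ∷ es) rewrite brackets-∷ t x v w | brackets-∷ t′ x v w | e =
      cong (bracket (colPaired mu rho i t x v) (x , v) ++_) (brackets-cong t t′ w es)

    brackets-middle : ∀ t u x v w → brackets mu rho i t (u ++ (x , v) ∷ w)
      ≡ brackets mu rho i t u ++ bracket (colPaired mu rho i t x v) (x , v) ++ brackets mu rho i t w
    brackets-middle t u x v w =
      trans (brackets-++ t u ((x , v) ∷ w)) (cong (brackets mu rho i t u ++_) (brackets-∷ t x v w))

    colPaired-raised : ∀ {s s′} → ColumnStrict s → ∀ x → AgreeExcept x s′ s →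
      entryAt mu rho s x ≡ just i → colPaired mu rho i s′ x (suc i) ≡ false
    colPaired-raised strict (t , r , c) agree x-i with suc i ≟ i
    ... | yes 1+i≡i = ⊥-elim (1+n≢n 1+i≡i)
    ... | no _ rewrite ≟-diag (refl {x = suc i}) with r
    ...   | zero = refl
    ...   | suc r′ rewrite agree (t , r′ , c) (1+n≢n ∘ cong rowIndex ∘ sym) =
            eqMN-≢ λ above a≡i → <-irrefl a≡i (strict t r′ c above x-i)

    colPaired-below : ∀ s t r c → entryAt mu rho s (t , suc r , c) ≡ just (suc i) →
      colPaired mu rho i s (t , r , c) i ≡ true
    colPaired-below s t r c below rewrite ≟-diag (refl {x = i}) | below = eqMN-self (suc i)

    -- The pairing of a letter depends only on its vertical neighbours. If one of them is x, column
    -- strictness rules out an i above x, and x being unpaired rules out an i+1 below x.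
    colPaired-others : ∀ {s s′} x → ColumnStrict s → AgreeExcept x s′ s →
      entryAt mu rho s x ≡ just i → colPaired mu rho i s x i ≡ false →
      ∀ t r c {a} → entryAt mu rho s (t , r , c) ≡ just a →
      colPaired mu rho i s′ (t , r , c) a ≡ colPaired mu rho i s (t , r , c) a
    colPaired-others x strict agree x-i x-unpaired t r c {a} y-a with a ≟ i
    ... | yes refl with (t , suc r , c) ≟ᶜ x
    ...   | yes refl = ⊥-elim (<-irrefl refl (strict t r c y-a x-i))
    ...   | no below≢x rewrite agree _ below≢x = refl
    colPaired-others x strict agree x-i x-unpaired t r c {a} y-a | no _ with a ≟ suc i
    ...   | no _ = refl
    colPaired-others x strict agree x-i x-unpaired t zero c y-a | no _ | yes refl = refl
    colPaired-others x strict agree x-i x-unpaired t (suc r) c y-a | no _ | yes refl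
      with (t , r , c) ≟ᶜ x
    ... | yes refl with () ← trans (sym (colPaired-below _ t r c y-a)) x-unpaired
    ... | no above≢x rewrite agree _ above≢x = refl

    closersOf : ShT n → List Cell
    closersOf s = proj₁ (unm mu rho i s)

    raise : ShT n → Cell → ShT n
    raise s x = setCell mu rho s x (suc i)

    module _ {s x before after} (word : readingWord mu rho s ≡ before ++ (x , i) ∷ after) where

      brackets-unpaired : colPaired mu rho i s x i ≡ false →
        brackets mu rho i s (readingWord mu rho s)
          ≡ brackets mu rho i s before ++ (x , cls) ∷ brackets mu rho i s after
      brackets-unpaired x-unpaired = begin
        brackets mu rho i s (readingWord mu rho s)       ≡⟨ cong (brackets mu rho i s) word ⟩
        brackets mu rho i s (before ++ (x , i) ∷ after)  ≡⟨ brackets-middle s before x i after ⟩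
        B₁ ++ bracket (colPaired mu rho i s x i) (x , i) ++ B₂
          ≡⟨ cong (λ p → B₁ ++ bracket p (x , i) ++ B₂) x-unpaired ⟩
        B₁ ++ bracket false (x , i) ++ B₂  ≡⟨ cong (λ β → B₁ ++ β ++ B₂) (bracket-closer x) ⟩
        B₁ ++ (x , cls) ∷ B₂               ∎
        where open ≡-Reasoning
              B₁ B₂ : List (Cell × Br)
              B₁ = brackets mu rho i s before
              B₂ = brackets mu rho i s after

      brackets-raise : ColumnStrict s → colPaired mu rho i s x i ≡ false →
        All (λ p → proj₁ p ≢ x) before → All (λ p → proj₁ p ≢ x) after →
        brackets mu rho i (raise s x) (readingWord mu rho (raise s x))
          ≡ brackets mu rho i s before ++ (x , opn) ∷ brackets mu rho i s after
      brackets-raise strict x-unpaired x∉before x∉after = begin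
        brackets mu rho i s′ (readingWord mu rho s′)          ≡⟨ cong (brackets mu rho i s′) raisedWord ⟩
        brackets mu rho i s′ (before ++ (x , suc i) ∷ after)  ≡⟨ brackets-middle s′ before x (suc i) after ⟩
        brackets mu rho i s′ before ++ bracket (colPaired mu rho i s′ x (suc i)) (x , suc i)
          ++ brackets mu rho i s′ after
          ≡⟨ cong₂ _++_ (brackets-cong s s′ before (All.tabulate (pairingKept ∘ ∈-++⁺ˡ)))
               (cong₂ (λ p u → bracket p (x , suc i) ++ u) (colPaired-raised strict x agree x-i)
                 (brackets-cong s s′ after (All.tabulate (pairingKept ∘ ∈-++⁺ʳ before ∘ there)))) ⟩
        B₁ ++ bracket false (x , suc i) ++ B₂  ≡⟨ cong (λ β → B₁ ++ β ++ B₂) (bracket-opener x) ⟩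
        B₁ ++ (x , opn) ∷ B₂                   ∎
        where
          open ≡-Reasoning
          s′ : ShT n
          s′ = raise s x
          B₁ B₂ : List (Cell × Br)
          B₁ = brackets mu rho i s before
          B₂ = brackets mu rho i s after
          raisedWord : readingWord mu rho s′ ≡ before ++ (x , suc i) ∷ after
          raisedWord = readingWord-setCell-middle s x (suc i) before after word x∉before x∉after
          inWord : ∀ {y a} → (y , a) ∈ before ++ (x , i) ∷ after → entryAt mu rho s y ≡ just a
          inWord q = readingWord-∈⁻ s (subst (_ ∈_) (sym word) q)
          x-i : entryAt mu rho s x ≡ just i
          x-i = inWord (∈-++⁺ʳ before (here refl))
          agree : AgreeExcept x s′ s
          agree = setCell-agreeExcept s x (suc i) x-i
          pairingKept : ∀ {y a} → (y , a) ∈ before ++ (x , i) ∷ after →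
            colPaired mu rho i s′ y a ≡ colPaired mu rho i s y a
          pairingKept {t , r , c} q = colPaired-others x strict agree x-i x-unpaired t r c (inWord q)

    record RaiseStep (s : ShT n) (x : Cell) (rest : List Cell) : Set where
      field
        before after  : List (Cell × ℕ)
        word          : readingWord mu rho s ≡ before ++ (x , i) ∷ after
        raisedWord    : readingWord mu rho (raise s x) ≡ before ++ (x , suc i) ∷ after
        closers-raise : closersOf (raise s x) ≡ rest
        rest-above    : All (λ y → level x ≤ level y) rest

    raiseStep : ∀ s → ColumnStrict s → ∀ x rest → closersOf s ≡ x ∷ rest → RaiseStep s x rest
    raiseStep s strict x rest h
      with x∈ , x-unpaired ← brackets-cls-∈ s _ (closers-∈ [] _ (head-∈ h))
      with before , after , word ← ∈-∃++ x∈ = record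
        { before = before
        ; after = after
        ; word = word
        ; raisedWord = readingWord-setCell-middle s x (suc i) before after word x∉before x∉after
        ; closers-raise =
            trans (cong (closers []) (brackets-raise word strict x-unpaired x∉before x∉after))
                  (proj₁ closersAfterRaise)
        ; rest-above = All.tabulate λ {y} y∈ →
            ≺⇒level-≥ {y} {x} (before-≺ (closers-∈ [] _ (subst (_ ∈_) (proj₂ closersAfterRaise) y∈)))
        }
      where
        sorted : All (λ p → proj₁ p ≺ x) before × All (λ p → x ≺ proj₁ p) after
        sorted = AllPairs-middle before after (subst (AllPairs _) word (readingWord-sorted s))
        x∉before : All (λ p → proj₁ p ≢ x) before
        x∉before = All.map ≺⇒≢ (proj₁ sorted)
        x∉after : All (λ p → proj₁ p ≢ x) after
        x∉after = All.map (λ x≺y → ≺⇒≢ x≺y ∘ sym) (proj₂ sorted)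
        B₁ B₂ : List (Cell × Br)
        B₁ = brackets mu rho i s before
        B₂ = brackets mu rho i s after
        before-≺ : ∀ {y br} → (y , br) ∈ B₁ → y ≺ x
        before-≺ q = All.lookup (proj₁ sorted) (proj₂ (brackets-∈ s before q))
        after-≻ : ∀ {y br} → (y , br) ∈ B₂ → x ≺ y
        after-≻ q = All.lookup (proj₂ sorted) (proj₂ (brackets-∈ s after q))
        closersAfterRaise : closers [] (B₁ ++ (x , opn) ∷ B₂) ≡ rest × rest ≡ closers [] B₁
        closersAfterRaise = raise-rightmost-closer x rest B₁ B₂
          (λ _ q → ≺⇒≢ (before-≺ q)) (λ _ q → ≺⇒≢ (after-≻ q) ∘ sym)
          (trans (cong (closers []) (sym (brackets-unpaired word x-unpaired))) h)

    module _ (N : ℕ) (lam nu : Vec ℕ n) (b : Vec ℕ (2 * n)) (b-mono : Nondecreasing b) where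

      FitsFlag : Cell × ℕ → Set
      FitsFlag (y , a) = ∀ β → vnth b (level y) ≡ just β → a ≤ β

      fitsFlag? : ∀ p → Dec (FitsFlag p)
      fitsFlag? (y , a) with vnth b (level y)
      ... | nothing = yes λ _ ()
      ... | just β = map′ (λ { a≤β _ refl → a≤β }) (λ fits → fits β refl) (a ≤? β)

      fitsFlag-level-mono : ∀ {a} x y → level x ≤ level y → FitsFlag (x , a) → FitsFlag (y , a)
      fitsFlag-level-mono x y x≤y x-fits β y-flag with β′ , x-flag , β′≤β ← vnth-mono b b-mono x≤y y-flag =
        ≤-trans (x-fits β′ x-flag) β′≤β

      Fits : ShT n → Set
      Fits s = All FitsFlag (readingWord mu rho s)

      fits? : ∀ s → Dec (Fits s)
      fits? s = All.all? fitsFlag? (readingWord mu rho s)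

      flagged⇒fits : ∀ s → Flagged mu rho b s → Fits s
      flagged⇒fits (T , U) (fitsT , fitsU) = All.tabulate fitsAt
        where fitsAt : ∀ {p} → p ∈ readingWord mu rho (T , U) → FitsFlag p
              fitsAt {(tT , r , c) , a} q β = fitsT r c a β (readingWord-∈⁻ (T , U) q)
              fitsAt {(tU , r , c) , a} q β = fitsU r c a β (readingWord-∈⁻ (T , U) q)

      fits⇒flagged : ∀ s → Fits s → Flagged mu rho b s
      fits⇒flagged s@(T , U) fits =
          (λ r c a β e → All.lookup fits (readingWord-∈⁺ s {tT , r , c} e) β)
        , (λ r c a β e → All.lookup fits (readingWord-∈⁺ s {tU , r , c} e) β)

      Raisable : Cell → Set
      Raisable y = FitsFlag (y , suc i)

      module _ {s x rest} (step : RaiseStep s x rest) where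
        open RaiseStep step

        raisable-of-fits : Fits (raise s x) → Raisable x
        raisable-of-fits fits′ =
          All.lookup fits′ (subst (_ ∈_) (sym raisedWord) (∈-++⁺ʳ before (here refl)))

        fits-raise : Fits s → Raisable x → Fits (raise s x)
        fits-raise fits x-ok = subst (All FitsFlag) (sym raisedWord)
          (All-replace-middle before after (subst (All FitsFlag) word fits) x-ok)

        fits-lower : Fits (raise s x) → Fits s
        fits-lower fits′ = subst (All FitsFlag) (sym word)
          (All-replace-middle before after (subst (All FitsFlag) raisedWord fits′)
            (λ β → ≤-trans (n≤1+n i) ∘ raisable-of-fits fits′ β))

      columnStrict : ∀ {s} → InB N lam mu nu rho s → ColumnStrict s
      columnStrict (ssytT , ssytU) tT r c = SSYT.colStrict ssytT r c _ _
      columnStrict (ssytT , ssytU) tU r c = SSYT.colStrict ssytU r c _ _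

      fOp-just : ∀ s {s′} → fOp mu rho i s ≡ just s′ →
        ∃₂ λ x rest → closersOf s ≡ x ∷ rest × s′ ≡ raise s x
      fOp-just s h with unm mu rho i s
      fOp-just s refl | x ∷ rest , _ = x , rest , refl , refl

      fOp-raiseStep : ∀ {s s′} → InB N lam mu nu rho s → fOp mu rho i s ≡ just s′ →
        ∃₂ λ x rest → closersOf s ≡ x ∷ rest × RaiseStep s x rest × s′ ≡ raise s x
      fOp-raiseStep {s} inB f with x , rest , h , refl ← fOp-just s f =
        x , rest , h , raiseStep s (columnStrict inB) x rest h , refl

      unfit-string : ∀ {s R} → FChain mu rho i s R → All (InB N lam mu nu rho) (s ∷ R) →
        ¬ Fits s → All (¬_ ∘ Fits) (s ∷ R)
      unfit-string (fend _) _ ¬fits = ¬fits ∷ []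
      unfit-string (fstep f chain) (inB ∷ inBs) ¬fits with _ , _ , _ , step , refl ← fOp-raiseStep inB f =
        ¬fits ∷ unfit-string chain inBs (¬fits ∘ fits-lower step)

      fitting-string : ∀ {s R} → FChain mu rho i s R → All (InB N lam mu nu rho) (s ∷ R) →
        Fits s → All Raisable (closersOf s) → All Fits (s ∷ R)
      fitting-string (fend _) _ fits _ = fits ∷ []
      fitting-string (fstep f chain) (inB ∷ inBs) fits raisable
        with _ , _ , h , step , refl ← fOp-raiseStep inB f
        with x-ok ∷ rest-ok ← subst (All Raisable) h raisable =
        fits ∷ fitting-string chain inBs (fits-raise step fits x-ok)
                 (subst (All Raisable) (sym (RaiseStep.closers-raise step)) rest-ok)

      raisable-closers : ∀ {s s′} → InB N lam mu nu rho s → fOp mu rho i s ≡ just s′ → Fits s′ →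
        All Raisable (closersOf s)
      raisable-closers inB f fits′ with x , _ , h , step , refl ← fOp-raiseStep inB f =
        subst (All Raisable) (sym h)
          (x-ok ∷ All.map (λ {y} x≤y → fitsFlag-level-mono x y x≤y x-ok) (RaiseStep.rest-above step))
        where x-ok : Raisable x
              x-ok = raisable-of-fits step fits′

      X : ShT n → Set
      X = InX N lam mu nu rho b

      extremal : ∀ S → IsString N lam mu nu rho i S →
        (∀ x → x ∈ S → ¬ X x)
        ⊎ (∀ x → x ∈ S → X x)
        ⊎ (∃ λ x → x ∈ S × X x × eOp mu rho i x ≡ nothing × (∀ y → y ∈ S → X y → y ≡ x))
      extremal (s₀ ∷ R) (inB , e₀ , chain) with fits? s₀
      ... | no ¬fits₀ = inj₁ λ y y∈ (_ , flagged) →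
        All.lookup (unfit-string chain inB ¬fits₀) y∈ (flagged⇒fits y flagged)
      extremal (s₀ ∷ []) (inB₀ ∷ [] , _ , fend _) | yes fits₀ =
        inj₂ (inj₁ λ { _ (here refl) → inB₀ , fits⇒flagged s₀ fits₀ })
      extremal (s₀ ∷ s₁ ∷ R) (inB₀ ∷ inB , e₀ , fstep f₀ chain) | yes fits₀ with fits? s₁
      ... | no ¬fits₁ = inj₂ (inj₂ (s₀ , here refl , (inB₀ , fits⇒flagged s₀ fits₀) , e₀ , onlyHead))
        where onlyHead : ∀ y → y ∈ s₀ ∷ s₁ ∷ R → X y → y ≡ s₀
              onlyHead y (here y≡s₀) _ = y≡s₀
              onlyHead y (there y∈) (_ , flagged) =
                ⊥-elim (All.lookup (unfit-string chain inB ¬fits₁) y∈ (flagged⇒fits y flagged))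
      ... | yes fits₁ =
        inj₂ (inj₁ λ y y∈ → All.lookup (inB₀ ∷ inB) y∈ , fits⇒flagged y (All.lookup allFit y∈))
        where allFit : All Fits (s₀ ∷ s₁ ∷ R)
              allFit = fitting-string (fstep f₀ chain) (inB₀ ∷ inB) fits₀ (raisable-closers inB₀ f₀ fits₁)

lemma4p1 : ∀ (n N : ℕ) (lam mu nu rho : Vec ℕ n) →
    IsPartition lam → IsPartition mu → IsPartition nu → IsPartition rho →
    mu ⊆ₚ lam → rho ⊆ₚ nu →
    ∀ (b : Vec ℕ (2 * n)) → Nondecreasing b →
    Extremal N lam mu nu rho (InX N lam mu nu rho b)
lemma4p1 n N lam mu nu rho _ _ _ _ _ _ b b-mono i _ _ = extremal mu rho i N lam nu b b-mono
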